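{- Let $\mathbb{M}\in\{\mathsf K,\mathsf D,\mathsf T,\mathsf{K4},\mathsf{S4}\}$. If the 2-sequent $\Gamma\vdash\Delta$ is derivable in $2_{\mathbb{M}}$, then $\Gamma\models_{\mathbb{M}}\Delta$.
   Context: Modal formulas over proposition symbols (set $At$) with $\neg,\wedge,\vee,\to,\Box,\Diamond$. Fix a countably infinite set of tokens; a position is a finite (possibly empty) sequence of tokens, $\circ$ concatenation, $\alpha\circ x=\alpha\circ\langle x\rangle$, $\beta\preceq\alpha$ means $\beta$ is a prefix of $\alpha$. A p-formula is $A^\alpha$; a 2-sequent is $\Gamma\vdash\Delta$ with $\Gamma,\Delta$ finite sequences of p-formulas; $I(\Gamma)=\{\beta:\exists A^\alpha\in\Gamma,\ \beta\preceq\alpha\}$. Calculus $2_{\mathsf{S4}}$: Axiom $A^\alpha\vdash A^\alpha$; Cut: from $\Gamma_1\vdash A^\alpha,\Delta_1$ and $\Gamma_2,A^\alpha\vdash\Delta_2$ infer $\Gamma_1,\Gamma_2\vdash\Delta_1,\Delta_2$; weakening, contraction, exchange; classical propositional sequent rules for $\neg,\wedge,\vee,\to$ with all active p-formulas at the same position; modal rules: ($\Box\vdash$) from $\Gamma,A^{\alpha\circ\beta}\vdash\Delta$ infer $\Gamma,(\Box A)^\alpha\vdash\Delta$; ($\vdash\Box$) from $\Gamma\vdash A^{\alpha\circ x},\Delta$ infer $\Gamma\vdash(\Box A)^\alpha,\Delta$; ($\Diamond\vdash$) from $\Gamma,A^{\alpha\circ x}\vdash\Delta$ infer $\Gamma,(\Diamond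 A)^\alpha\vdash\Delta$; ($\vdash\Diamond$) from $\Gamma\vdash A^{\alpha\circ\beta},\Delta$ infer $\Gamma\vdash(\Diamond A)^\alpha,\Delta$; $\beta$ a position, $x$ a token, and in $\vdash\Box,\Diamond\vdash$, $\alpha\circ x\notin I(\Gamma,\Delta)$. $2_{\mathsf T},2_{\mathsf D},2_{\mathsf{K4}},2_{\mathsf K}$ add constraints on $\Box\vdash,\vdash\Diamond$: $2_{\mathsf T}$: $\beta$ empty or a single token; $2_{\mathsf D}$: $\beta$ a single token; $2_{\mathsf{K4}}$: $\beta$ nonempty and $\Gamma$ or $\Delta$ contains some $B^{\alpha\circ\beta\circ\eta}$; $2_{\mathsf K}$: $\beta$ a single token and $\Gamma$ or $\Delta$ contains some $B^{\alpha\circ\beta\circ\eta}$. In $2_{\mathsf K},2_{\mathsf{K4}}$ Cut requires $\alpha\in I(\Gamma_1,\Delta_1)$ or $\alpha\in I(\Gamma_2,\Delta_2)$. Semantics: a tree is a set $\Theta$ of finite sequences of natural numbers containing $\langle\,\rangle$ and closed under prefixes. For nodes, $s\lhd t$ iff $t=s\circ\langle k\rangle$ for some $k$; $\lhd^0$ is its reflexive closure, $\lhd^+$ its transitive closure, $\unlhd$ its reflexive-transitive closure. A Kripke model is $\langle\Theta,\nu,R\rangle$ with $\nu:\Theta\to 2^{At}$, $R\subseteq\Theta\times\Theta$, with the standard forcing relation ($s\models\Box A$ iff $t\models A$ for all $t$ with $sRt$, $s\models\Diamond A$ iff some such $t$ forces $A$). It is a $\mathsf K$-model if $R=\lhd$;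 a $\mathsf D$-model if $\Theta$ has no leaves and $R=\lhd$; a $\mathsf T$-model if $R=\lhd^0$; a $\mathsf{K4}$-model if $R=\lhd^+$; an $\mathsf{S4}$-model if $R=\unlhd$. A $2_{\mathbb M}$ structure is a pair of an $\mathbb M$-model and a partial map $\rho$ from positions to $\Theta$ such that $\rho(\alpha)$ defined implies $\rho(\beta)$ defined for every prefix $\beta$ of $\alpha$, and moreover, writing $\alpha\lhd\beta$ for $\beta=\alpha\circ x$ with $x$ a token: for $\mathsf K$, if $\alpha\lhd\beta$ and both $\rho(\alpha),\rho(\beta)$ are defined then $\rho(\alpha)\lhd\rho(\beta)$; for $\mathsf{K4}$, same with $\rho(\alpha)\lhd^+\rho(\beta)$; for $\mathsf D$, $\rho$ is total and $\alpha\lhd\beta\Rightarrow\rho(\alpha)\lhd\rho(\beta)$; for $\mathsf T$, $\rho$ total and $\alpha\lhd\beta\Rightarrow\rho(\alpha)\lhd^0\rho(\beta)$; for $\mathsf{S4}$, $\rho$ total and $\alpha\lhd\beta\Rightarrow\rho(\alpha)\unlhd\rho(\beta)$. Define $\rho\models^\ell A^\alpha$ iff $\rho(\alpha)$ is defined and $\rho(\alpha)\models A$; $\rho\models^r A^\alpha$ iff ($\rho(\alpha)$ defined implies $\rho(\alpha)\models A$). A structure satisfies $\Gamma\vdash\Delta$ iff, whenever $\rho\models^\ell A^\alpha$ for all $A^\alpha\in\Gamma$, there is $B^\beta\in\Delta$ with $\rho\models^r B^\beta$. $\Gamma\models_{\mathbb M}\Delta$ means every $2_{\mathbb M}$ structure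 satisfies $\Gamma\vdash\Delta$. -}

module Defs where

open import Level using (0ℓ)
open import Data.Nat using (ℕ; _≤_)
open import Data.List using (List; []; _∷_; _++_; [_]; length)
open import Data.List.Relation.Unary.All using (All)
open import Data.List.Relation.Unary.Any using (Any)
open import Data.List.Membership.Propositional using (_∈_)
open import Data.Product using (Σ; ∃; ∃-syntax; _×_; _,_)
open import Data.Sum using (_⊎_)
open import Data.Unit using (⊤)
open import Data.Maybe using (Maybe; just)
open import Relation.Nullary using (¬_)
open import Relation.Binary.PropositionalEquality using (_≡_; _≢_)
open import Relation.Binary.Construct.Closure.Reflexive using (ReflClosure)
open import Relation.Binary.Construct.Closure.Transitive using (TransClosure)
open import Relation.Binary.Construct.Closure.ReflexiveTransitive using (Star)

data Logic : Set where
  K D T K4 S4 : Logic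

data Fm (At : Set) : Set where
  atom : At → Fm At
  ¬′_  : Fm At → Fm At
  _∧′_ : Fm At → Fm At → Fm At
  _∨′_ : Fm At → Fm At → Fm At
  _⇒′_ : Fm At → Fm At → Fm At
  □_   : Fm At → Fm At
  ◇_   : Fm At → Fm At

Token : Set
Token = ℕ

Pos : Set
Pos = List Token

_≼_ : Pos → Pos → Set
β ≼ α = ∃[ γ ] (β ++ γ ≡ α)

data PFm (At : Set) : Set where
  _^_ : Fm At → Pos → PFm At

pos : {At : Set} → PFm At → Pos
pos (A ^ α) = α

InI : {At : Set} → Pos → List (PFm At) → Set
InI β Γ = Any (λ φ → β ≼ pos φ) Γ

Witness : {At : Set} → Pos → Pos → List (PFm At) → List (PFm At) → Set
Witness {At} α β Γ Δ = ∃[ B ] ∃[ η ] ((B ^ (α ++ β ++ η)) ∈ (Γ ++ Δ))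

BoxLCond : {At : Set} → Logic → Pos → Pos → List (PFm At) → List (PFm At) → Set
BoxLCond S4 α β Γ Δ = ⊤
BoxLCond T  α β Γ Δ = length β ≤ 1
BoxLCond D  α β Γ Δ = length β ≡ 1
BoxLCond K4 α β Γ Δ = (β ≢ []) × Witness α β Γ Δ
BoxLCond K  α β Γ Δ = (length β ≡ 1) × Witness α β Γ Δ

CutCond : {At : Set} → Logic → Pos →
          List (PFm At) → List (PFm At) → List (PFm At) → List (PFm At) → Set
CutCond K  α Γ₁ Δ₁ Γ₂ Δ₂ = InI α (Γ₁ ++ Δ₁) ⊎ InI α (Γ₂ ++ Δ₂)
CutCond K4 α Γ₁ Δ₁ Γ₂ Δ₂ = InI α (Γ₁ ++ Δ₁) ⊎ InI α (Γ₂ ++ Δ₂)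
CutCond D  α Γ₁ Δ₁ Γ₂ Δ₂ = ⊤
CutCond T  α Γ₁ Δ₁ Γ₂ Δ₂ = ⊤
CutCond S4 α Γ₁ Δ₁ Γ₂ Δ₂ = ⊤

-- Derivability in 2_M.  "Γ, A" is written  A ∷ Γ  (exchange is a rule).

data Deriv {At : Set} (M : Logic) : List (PFm At) → List (PFm At) → Set where
  ax     : ∀ {φ} → Deriv M [ φ ] [ φ ]
  cut    : ∀ {Γ₁ Γ₂ Δ₁ Δ₂ A α} → CutCond M α Γ₁ Δ₁ Γ₂ Δ₂ →
           Deriv M Γ₁ ((A ^ α) ∷ Δ₁) → Deriv M ((A ^ α) ∷ Γ₂) Δ₂ →
           Deriv M (Γ₁ ++ Γ₂) (Δ₁ ++ Δ₂)
  weakL  : ∀ {Γ Δ φ} → Deriv M Γ Δ → Deriv M (φ ∷ Γ) Δ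
  weakR  : ∀ {Γ Δ φ} → Deriv M Γ Δ → Deriv M Γ (φ ∷ Δ)
  contrL : ∀ {Γ Δ φ} → Deriv M (φ ∷ φ ∷ Γ) Δ → Deriv M (φ ∷ Γ) Δ
  contrR : ∀ {Γ Δ φ} → Deriv M Γ (φ ∷ φ ∷ Δ) → Deriv M Γ (φ ∷ Δ)
  exchL  : ∀ {Γ₁ Γ₂ Δ φ ψ} → Deriv M (Γ₁ ++ φ ∷ ψ ∷ Γ₂) Δ →
           Deriv M (Γ₁ ++ ψ ∷ φ ∷ Γ₂) Δ
  exchR  : ∀ {Γ Δ₁ Δ₂ φ ψ} → Deriv M Γ (Δ₁ ++ φ ∷ ψ ∷ Δ₂) →
           Deriv M Γ (Δ₁ ++ ψ ∷ φ ∷ Δ₂)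
  negL   : ∀ {Γ Δ A α} → Deriv M Γ ((A ^ α) ∷ Δ) → Deriv M (((¬′ A) ^ α) ∷ Γ) Δ
  negR   : ∀ {Γ Δ A α} → Deriv M ((A ^ α) ∷ Γ) Δ → Deriv M Γ (((¬′ A) ^ α) ∷ Δ)
  andL₁  : ∀ {Γ Δ A B α} → Deriv M ((A ^ α) ∷ Γ) Δ → Deriv M (((A ∧′ B) ^ α) ∷ Γ) Δ
  andL₂  : ∀ {Γ Δ A B α} → Deriv M ((B ^ α) ∷ Γ) Δ → Deriv M (((A ∧′ B) ^ α) ∷ Γ) Δ
  andR   : ∀ {Γ Δ A B α} → Deriv M Γ ((A ^ α) ∷ Δ) → Deriv M Γ ((B ^ α) ∷ Δ) →
           Deriv M Γ (((A ∧′ B) ^ α) ∷ Δ)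
  orL    : ∀ {Γ Δ A B α} → Deriv M ((A ^ α) ∷ Γ) Δ → Deriv M ((B ^ α) ∷ Γ) Δ →
           Deriv M (((A ∨′ B) ^ α) ∷ Γ) Δ
  orR₁   : ∀ {Γ Δ A B α} → Deriv M Γ ((A ^ α) ∷ Δ) → Deriv M Γ (((A ∨′ B) ^ α) ∷ Δ)
  orR₂   : ∀ {Γ Δ A B α} → Deriv M Γ ((B ^ α) ∷ Δ) → Deriv M Γ (((A ∨′ B) ^ α) ∷ Δ)
  impL   : ∀ {Γ₁ Γ₂ Δ₁ Δ₂ A B α} → Deriv M Γ₁ ((A ^ α) ∷ Δ₁) →
           Deriv M ((B ^ α) ∷ Γ₂) Δ₂ →
           Deriv M (((A ⇒′ B) ^ α) ∷ (Γ₁ ++ Γ₂)) (Δ₁ ++ Δ₂)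
  impR   : ∀ {Γ Δ A B α} → Deriv M ((A ^ α) ∷ Γ) ((B ^ α) ∷ Δ) →
           Deriv M Γ (((A ⇒′ B) ^ α) ∷ Δ)
  boxL   : ∀ {Γ Δ A α β} → BoxLCond M α β Γ Δ →
           Deriv M ((A ^ (α ++ β)) ∷ Γ) Δ → Deriv M (((□ A) ^ α) ∷ Γ) Δ
  boxR   : ∀ {Γ Δ A α} (x : Token) → ¬ InI (α ++ [ x ]) (Γ ++ Δ) →
           Deriv M Γ ((A ^ (α ++ [ x ])) ∷ Δ) → Deriv M Γ (((□ A) ^ α) ∷ Δ)
  diaL   : ∀ {Γ Δ A α} (x : Token) → ¬ InI (α ++ [ x ]) (Γ ++ Δ) →
           Deriv M ((A ^ (α ++ [ x ])) ∷ Γ) Δ → Deriv M (((◇ A) ^ α) ∷ Γ) Δ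
  diaR   : ∀ {Γ Δ A α β} → BoxLCond M α β Γ Δ →
           Deriv M Γ ((A ^ (α ++ β)) ∷ Δ) → Deriv M Γ (((◇ A) ^ α) ∷ Δ)

-- Semantics: trees are sets of finite sequences of naturals

Node : Set
Node = List ℕ

_◁_ : Node → Node → Set
s ◁ t = ∃[ k ] (t ≡ s ++ [ k ])

Acc : Logic → Node → Node → Set
Acc K  = _◁_
Acc D  = _◁_
Acc T  = ReflClosure _◁_
Acc K4 = TransClosure _◁_
Acc S4 = Star _◁_

TreeCond : Logic → (Node → Set) → Set
TreeCond D Θ = ∀ s → Θ s → ∃[ k ] Θ (s ++ [ k ])
TreeCond _ Θ = ⊤

TotalCond : Logic → (Pos → Maybe Node) → Set
TotalCond K  ρ = ⊤
TotalCond K4 ρ = ⊤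
TotalCond D  ρ = ∀ α → ∃[ s ] (ρ α ≡ just s)
TotalCond T  ρ = ∀ α → ∃[ s ] (ρ α ≡ just s)
TotalCond S4 ρ = ∀ α → ∃[ s ] (ρ α ≡ just s)

Forces : {At : Set} → (Node → Set) → (Node → At → Set) → (Node → Node → Set) →
         Node → Fm At → Set
Forces Θ ν R s (atom p) = ν s p
Forces Θ ν R s (¬′ A)   = ¬ Forces Θ ν R s A
Forces Θ ν R s (A ∧′ B) = Forces Θ ν R s A × Forces Θ ν R s B
Forces Θ ν R s (A ∨′ B) = Forces Θ ν R s A ⊎ Forces Θ ν R s B
Forces Θ ν R s (A ⇒′ B) = Forces Θ ν R s A → Forces Θ ν R s B
Forces Θ ν R s (□ A)    = ∀ t → Θ t → R s t → Forces Θ ν R t A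
Forces Θ ν R s (◇ A)    = ∃[ t ] (Θ t × R s t × Forces Θ ν R t A)

record Structure (At : Set) (M : Logic) : Set₁ where
  field
    Θ          : Node → Set
    root       : Θ []
    prefClosed : ∀ s t → Θ (s ++ t) → Θ s
    ν          : Node → At → Set
    treeCond   : TreeCond M Θ
    ρ          : Pos → Maybe Node
    ρ-into     : ∀ α s → ρ α ≡ just s → Θ s
    ρ-prefix   : ∀ α β s → β ≼ α → ρ α ≡ just s → ∃[ t ] (ρ β ≡ just t)
    ρ-total    : TotalCond M ρ
    ρ-mono     : ∀ α x s t → ρ α ≡ just s → ρ (α ++ [ x ]) ≡ just t → Acc M s t

  _⊩_ : Node → Fm At → Set
  s ⊩ A = Forces Θ ν (Acc M) s A

  ⊨ˡ : PFm At → Set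
  ⊨ˡ (A ^ α) = ∃[ s ] (ρ α ≡ just s × s ⊩ A)

  ⊨ʳ : PFm At → Set
  ⊨ʳ (A ^ α) = ∀ s → ρ α ≡ just s → s ⊩ A

  Satisfies : List (PFm At) → List (PFm At) → Set
  Satisfies Γ Δ = All ⊨ˡ Γ → Any ⊨ʳ Δ

_⊨[_]_ : {At : Set} → List (PFm At) → Logic → List (PFm At) → Set₁
_⊨[_]_ {At} Γ M Δ = (S : Structure At M) → Structure.Satisfies S Γ Δ

module Submission where

-- Structural and propositional rules are sound structure by
-- structure (the right rules use excluded middle to split on the side formulas).
-- Two kinds of modal rules need more:
--   * (□⊢) and (⊢◇): the side condition on β guarantees that ρ(α∘β), when needed, is an
--     accessible successor of ρ(α); for K and K4 this uses that a position occurring in the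
--     sequent is either defined or makes the sequent hold vacuously (the same fact gives the
--     restricted Cut of K and K4).
--   * (⊢□) and (◇⊢): given ρ(α) = s and a successor t of s, we graft onto ρ a map sending the
--     fresh position α∘x to t, with the cone above α∘x sent along a "rooted map" at t that
--     every M-model provides.  Since the sequent does not mention this cone, it means the same
--     in the grafted structure, where the premise is applied.

open import Defs
open import Level using (0ℓ)
open import Function using (_∘_)
open import Data.Nat using (_≟_; s≤s)
open import Data.List using (List; []; _∷_; _++_; [_])
open import Data.List.Properties using (++-assoc; ++-identityʳ; ++-cancelˡ; ∷-injective)
open import Data.List.Relation.Unary.All using (All; []; _∷_)
import Data.List.Relation.Unary.All.Properties as All
open import Data.List.Relation.Unary.Any as Any using (Any; here; there)
import Data.List.Relation.Unary.Any.Properties as AnyP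
open import Data.List.Relation.Binary.Permutation.Propositional using (swap; ↭-refl)
open import Data.List.Relation.Binary.Permutation.Propositional.Properties
  using (All-resp-↭; Any-resp-↭; ++⁺ˡ)
open import Data.Maybe using (Maybe; just; nothing)
open import Data.Maybe.Properties using (just-injective)
open import Data.Product using (Σ; ∃-syntax; _×_; _,_; proj₁; proj₂; map₂)
open import Data.Sum using (_⊎_; inj₁; inj₂)
import Data.Sum as Sum
open import Data.Unit using (tt)
open import Data.Empty using (⊥-elim)
open import Relation.Nullary using (¬_; Dec; yes; no)
open import Relation.Binary.Definitions using (Transitive)
open import Relation.Binary.PropositionalEquality
  using (_≡_; refl; sym; trans; cong; subst; subst₂)
open import Relation.Binary.Construct.Closure.Reflexive using () renaming (refl to stay)
open import Relation.Binary.Construct.Closure.Transitive using (transitive)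
open import Relation.Binary.Construct.Closure.ReflexiveTransitive using (ε; _◅◅_)
open import Axiom.ExcludedMiddle using (ExcludedMiddle)

_≼?_ : (P γ : Pos) → Dec (P ≼ γ)
[]      ≼? γ       = yes (γ , refl)
(a ∷ P) ≼? []      = no λ { (_ , ()) }
(a ∷ P) ≼? (b ∷ γ) with a ≟ b | P ≼? γ
... | no a≢b   | _            = no λ { (_ , eq) → a≢b (proj₁ (∷-injective eq)) }
... | yes refl | yes (δ , eq) = yes (δ , cong (a ∷_) eq)
... | yes refl | no P⋠γ       = no λ { (δ , eq) → P⋠γ (δ , proj₂ (∷-injective eq)) }

prefix-outside-cone : ∀ α x δ β → β ≼ (α ++ x ∷ δ) → ¬ ((α ++ [ x ]) ≼ β) → β ≼ α
prefix-outside-cone []      x δ []      _        _   = [] , refl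
prefix-outside-cone []      x δ (b ∷ β) (_ , eq) out with ∷-injective eq
... | refl , _ = ⊥-elim (out (β , refl))
prefix-outside-cone (a ∷ α) x δ []      _        _   = a ∷ α , refl
prefix-outside-cone (a ∷ α) x δ (b ∷ β) (η , eq) out with ∷-injective eq
... | refl , eq′ =
  let γ , βγ≡α = prefix-outside-cone α x δ β (η , eq′) (λ { (ζ , q) → out (ζ , cong (a ∷_) q) })
  in γ , cong (a ∷_) βγ≡α

enter-cone : ∀ α x δ γ y → γ ++ [ y ] ≡ α ++ x ∷ δ → ¬ ((α ++ [ x ]) ≼ γ) → γ ≡ α × δ ≡ []
enter-cone []          x δ []      y eq _ with ∷-injective eq
... | refl , refl = refl , refl
enter-cone []          x δ (g ∷ γ) y eq out with ∷-injective eq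
... | refl , _ = ⊥-elim (out (γ , refl))
enter-cone (a ∷ [])    x δ []      y eq _ with ∷-injective eq
... | _ , ()
enter-cone (a ∷ _ ∷ _) x δ []      y eq _ with ∷-injective eq
... | _ , ()
enter-cone (a ∷ α)     x δ (g ∷ γ) y eq out with ∷-injective eq
... | refl , eq′ with enter-cone α x δ γ y eq′ (λ { (ζ , q) → out (ζ , cong (a ∷_) q) })
... | refl , refl = refl , refl

witness-in-I : ∀ {At} α β (Γ Δ : List (PFm At)) → Witness α β Γ Δ → InI (α ++ β) (Γ ++ Δ)
witness-in-I α β Γ Δ (B , η , B∈ΓΔ) = Any.map (λ { refl → η , ++-assoc α β η }) B∈ΓΔ

Total : (Pos → Maybe Node) → Set
Total f = ∀ α → ∃[ s ] (f α ≡ just s)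

Covered : (f g h : Pos → Maybe Node) → Set
Covered f g h = ∀ γ → (∃[ δ ] (h γ ≡ f δ)) ⊎ (h γ ≡ g γ)

total-cover : ∀ {f g h} → Covered f g h → Total f → Total g → Total h
total-cover cover f-total g-total γ with cover γ
... | inj₁ (δ , hγ≡fδ) = map₂ (trans hγ≡fδ) (f-total δ)
... | inj₂ hγ≡gγ       = map₂ (trans hγ≡gγ) (g-total γ)

totalCond-cover : ∀ M {f g h} → Covered f g h → TotalCond M f → TotalCond M g → TotalCond M h
totalCond-cover K  _     _ _ = tt
totalCond-cover K4 _     _ _ = tt
totalCond-cover D  cover f g = total-cover cover f g
totalCond-cover T  cover f g = total-cover cover f g
totalCond-cover S4 cover f g = total-cover cover f g

-- A map from positions into Θ sending the empty position to c and obeying the conditions on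
-- the ρ of a 2_M structure.  It provides the values on the cone above a fresh position.
record Rooted (M : Logic) (Θ : Node → Set) (c : Node) : Set where
  field
    ext        : Pos → Maybe Node
    ext-root   : ext [] ≡ just c
    ext-into   : ∀ δ u → ext δ ≡ just u → Θ u
    ext-prefix : ∀ δ η u → ext (δ ++ η) ≡ just u → ∃[ v ] (ext δ ≡ just v)
    ext-mono   : ∀ δ y u v → ext δ ≡ just u → ext (δ ++ [ y ]) ≡ just v → Acc M u v
    ext-total  : TotalCond M ext

onlyRoot : Node → Pos → Maybe Node
onlyRoot c []      = just c
onlyRoot c (_ ∷ _) = nothing

rootOnly : ∀ {M Θ c} → Θ c → TotalCond M (onlyRoot c) → Rooted M Θ c
rootOnly {M} {Θ} {c} θ total = record
  { ext = onlyRoot c ; ext-root = refl ; ext-into = into ; ext-prefix = prefix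
  ; ext-mono = mono ; ext-total = total }
  where
  into : ∀ δ u → onlyRoot c δ ≡ just u → Θ u
  into []      _ refl = θ
  into (_ ∷ _) _ ()

  prefix : ∀ δ η u → onlyRoot c (δ ++ η) ≡ just u → ∃[ v ] (onlyRoot c δ ≡ just v)
  prefix []      _ _ _  = c , refl
  prefix (_ ∷ _) _ _ ()

  mono : ∀ δ y u v → onlyRoot c δ ≡ just u → onlyRoot c (δ ++ [ y ]) ≡ just v → Acc M u v
  mono []      _ _ _ _  ()
  mono (_ ∷ _) _ _ _ () _

constant : ∀ {M Θ c} → Θ c → Acc M c c → TotalCond M (λ _ → just c) → Rooted M Θ c
constant {c = c} θ c-c total = record
  { ext = λ _ → just c ; ext-root = refl
  ; ext-into = λ { _ _ refl → θ } ; ext-prefix = λ _ _ _ _ → c , refl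
  ; ext-mono = λ { _ _ _ _ refl refl → c-c } ; ext-total = total }

module _ {Θ : Node → Set} (noLeaf : TreeCond D Θ) where

  descend : ∀ c → Θ c → Pos → Σ Node Θ
  descend c θ []      = c , θ
  descend c θ (_ ∷ δ) = descend (c ++ [ proj₁ (noLeaf c θ) ]) (proj₂ (noLeaf c θ)) δ

  descend-snoc : ∀ c θ δ y → proj₁ (descend c θ δ) ◁ proj₁ (descend c θ (δ ++ [ y ]))
  descend-snoc c θ []      y = proj₁ (noLeaf c θ) , refl
  descend-snoc c θ (_ ∷ δ) y = descend-snoc _ _ δ y

  -- A total map along an infinite branch below c (D-models have no leaves).
  branch : ∀ {c} → Θ c → Rooted D Θ c
  branch {c} θ = record
    { ext = λ δ → just (proj₁ (descend c θ δ)) ; ext-root = refl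
    ; ext-into = λ { δ _ refl → proj₂ (descend c θ δ) }
    ; ext-prefix = λ _ _ _ _ → _ , refl
    ; ext-mono = λ { δ y _ _ refl refl → descend-snoc c θ δ y }
    ; ext-total = λ _ → _ , refl }

rooted : ∀ M {Θ} → TreeCond M Θ → ∀ {c} → Θ c → Rooted M Θ c
rooted K  _      θ = rootOnly θ tt
rooted K4 _      θ = rootOnly θ tt
rooted D  noLeaf θ = branch noLeaf θ
rooted T  _      θ = constant θ stay (λ _ → _ , refl)
rooted S4 _      θ = constant θ ε    (λ _ → _ , refl)

-- Given ρ(α) = s and an accessible t ∈ Θ, replace ρ on the cone above P = α∘x by a rooted map
-- at t.  The result is again a 2_M structure, sends P to t, and agrees with ρ off the cone.
module Graft {At M} (S : Structure At M) (α : Pos) (x : Token) {s t : Node}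
             (ρα : Structure.ρ S α ≡ just s) (θt : Structure.Θ S t) (s-t : Acc M s t) where
  open Structure S
  open Rooted (rooted M treeCond θt)

  P : Pos
  P = α ++ [ x ]

  ρ′ : Pos → Maybe Node
  ρ′ γ with P ≼? γ
  ... | yes (δ , _) = ext δ
  ... | no _        = ρ γ

  ρ′-inside : ∀ {γ δ} → P ++ δ ≡ γ → ρ′ γ ≡ ext δ
  ρ′-inside {γ} {δ} Pδ≡γ with P ≼? γ
  ... | yes (δ′ , Pδ′≡γ) = cong ext (++-cancelˡ P δ′ δ (trans Pδ′≡γ (sym Pδ≡γ)))
  ... | no P⋠γ           = ⊥-elim (P⋠γ (δ , Pδ≡γ))

  ρ′-outside : ∀ {γ} → ¬ (P ≼ γ) → ρ′ γ ≡ ρ γ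
  ρ′-outside {γ} P⋠γ with P ≼? γ
  ... | yes P≼γ = ⊥-elim (P⋠γ P≼γ)
  ... | no _    = refl

  data Cone (γ : Pos) : Set where
    inside  : ∀ {δ} → P ++ δ ≡ γ → Cone γ
    outside : ¬ (P ≼ γ) → Cone γ

  cone : ∀ γ → Cone γ
  cone γ with P ≼? γ
  ... | yes (_ , Pδ≡γ) = inside Pδ≡γ
  ... | no P⋠γ         = outside P⋠γ

  covered : Covered ext ρ ρ′
  covered γ with cone γ
  ... | inside {δ} Pδ≡γ = inj₁ (δ , ρ′-inside Pδ≡γ)
  ... | outside P⋠γ     = inj₂ (ρ′-outside P⋠γ)

  -- The conditions of a 2_M structure for ρ′; the only new step of mono′ is α ↦ α∘x, s to t.
  into′ : ∀ γ u → ρ′ γ ≡ just u → Θ u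
  into′ γ u eq with covered γ
  ... | inj₁ (δ , e) = ext-into δ u (trans (sym e) eq)
  ... | inj₂ e       = ρ-into γ u (trans (sym e) eq)

  prefix′ : ∀ γ β u → β ≼ γ → ρ′ γ ≡ just u → ∃[ v ] (ρ′ β ≡ just v)
  prefix′ γ β u (η , βη≡γ) eq with cone β | cone γ
  ... | inside {δ} Pδ≡β | _ =
    map₂ (trans (ρ′-inside Pδ≡β)) (ext-prefix δ η u (trans (sym (ρ′-inside Pδη≡γ)) eq))
    where
    Pδη≡γ : P ++ (δ ++ η) ≡ γ
    Pδη≡γ = trans (sym (++-assoc P δ η)) (trans (cong (_++ η) Pδ≡β) βη≡γ)
  ... | outside P⋠β | inside {δ} Pδ≡γ =
    map₂ (trans (ρ′-outside P⋠β)) (ρ-prefix α β s (prefix-outside-cone α x δ β β≼αxδ P⋠β) ρα)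
    where
    β≼αxδ : β ≼ (α ++ x ∷ δ)
    β≼αxδ = η , trans βη≡γ (trans (sym Pδ≡γ) (++-assoc α [ x ] δ))
  ... | outside P⋠β | outside P⋠γ =
    map₂ (trans (ρ′-outside P⋠β)) (ρ-prefix γ β u (η , βη≡γ) (trans (sym (ρ′-outside P⋠γ)) eq))

  mono′ : ∀ γ y u v → ρ′ γ ≡ just u → ρ′ (γ ++ [ y ]) ≡ just v → Acc M u v
  mono′ γ y u v eu ev with cone γ | cone (γ ++ [ y ])
  ... | inside {δ} Pδ≡γ | _ =
    ext-mono δ y u v (trans (sym (ρ′-inside Pδ≡γ)) eu) (trans (sym (ρ′-inside Pδy≡γy)) ev)
    where
    Pδy≡γy : P ++ (δ ++ [ y ]) ≡ γ ++ [ y ]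
    Pδy≡γy = trans (sym (++-assoc P δ [ y ])) (cong (_++ [ y ]) Pδ≡γ)
  ... | outside P⋠γ | outside P⋠γy =
    ρ-mono γ y u v (trans (sym (ρ′-outside P⋠γ)) eu) (trans (sym (ρ′-outside P⋠γy)) ev)
  ... | outside P⋠γ | inside {δ} Pδ≡γy
    with enter-cone α x δ γ y (trans (sym Pδ≡γy) (++-assoc α [ x ] δ)) P⋠γ
  ... | refl , refl = subst₂ (Acc M) s≡u t≡v s-t
    where
    s≡u : s ≡ u
    s≡u = just-injective (trans (sym ρα) (trans (sym (ρ′-outside P⋠γ)) eu))
    t≡v : t ≡ v
    t≡v = just-injective (trans (sym ext-root) (trans (sym (ρ′-inside Pδ≡γy)) ev))

  grafted : Structure At M
  grafted = record
    { Θ = Θ ; root = root ; prefClosed = prefClosed ; ν = ν ; treeCond = treeCond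
    ; ρ = ρ′ ; ρ-into = into′ ; ρ-prefix = prefix′ ; ρ-mono = mono′
    ; ρ-total = totalCond-cover M covered ext-total ρ-total }

  graft-root : ρ′ P ≡ just t
  graft-root = trans (ρ′-inside (++-identityʳ P)) ext-root

  agreeˡ : ∀ Γ → ¬ InI P Γ → All ⊨ˡ Γ → All (Structure.⊨ˡ grafted) Γ
  agreeˡ []            _     []                = []
  agreeˡ ((A ^ β) ∷ Γ) fresh ((u , e , a) ∷ h) =
    (u , trans (ρ′-outside (fresh ∘ here)) e , a) ∷ agreeˡ Γ (fresh ∘ there) h

  agreeʳ : ∀ Δ → ¬ InI P Δ → Any (Structure.⊨ʳ grafted) Δ → Any ⊨ʳ Δ
  agreeʳ ((A ^ β) ∷ Δ) fresh (here a)  = here (λ u e → a u (trans (ρ′-outside (fresh ∘ here)) e))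
  agreeʳ (_ ∷ Δ)       fresh (there q) = there (agreeʳ Δ (fresh ∘ there) q)

module Definedness {At M} (S : Structure At M) where
  open Structure S

  Defined : Pos → Set
  Defined α = ∃[ s ] (ρ α ≡ just s)

  defined? : ∀ α → Dec (Defined α)
  defined? α with ρ α
  ... | just s  = yes (s , refl)
  ... | nothing = no λ { (_ , ()) }

  defined-under-Γ : ∀ α Γ → InI α Γ → All ⊨ˡ Γ → Defined α
  defined-under-Γ α ((A ^ β) ∷ _) (here α≼β) ((u , e , _) ∷ _) = ρ-prefix β α u α≼β e
  defined-under-Γ α (_ ∷ Γ)       (there i)  (_ ∷ h)           = defined-under-Γ α Γ i h

  vacuous-in-Δ : ∀ α Δ → InI α Δ → ¬ Defined α → Any ⊨ʳ Δ
  vacuous-in-Δ α ((A ^ β) ∷ _) (here α≼β) undef =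
    here (λ u e → ⊥-elim (undef (ρ-prefix β α u α≼β e)))
  vacuous-in-Δ α (_ ∷ Δ)       (there i)  undef = there (vacuous-in-Δ α Δ i undef)

  defined-or-vacuous : ∀ α Γ Δ → InI α (Γ ++ Δ) → All ⊨ˡ Γ → Defined α ⊎ Any ⊨ʳ Δ
  defined-or-vacuous α Γ Δ i h with defined? α | AnyP.++⁻ Γ i
  ... | yes d     | _        = inj₁ d
  ... | no undef  | inj₁ iΓ  = ⊥-elim (undef (defined-under-Γ α Γ iΓ h))
  ... | no undef  | inj₂ iΔ  = inj₂ (vacuous-in-Δ α Δ iΔ undef)

  cut-position-occurs : ∀ {α Γ₁ Δ₁ Γ₂ Δ₂} → InI α (Γ₁ ++ Δ₁) ⊎ InI α (Γ₂ ++ Δ₂) →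
                        All ⊨ˡ Γ₁ → All ⊨ˡ Γ₂ → Defined α ⊎ Any ⊨ʳ (Δ₁ ++ Δ₂)
  cut-position-occurs {α} {Γ₁} {Δ₁} (inj₁ i) h₁ _ =
    Sum.map₂ AnyP.++⁺ˡ (defined-or-vacuous α Γ₁ Δ₁ i h₁)
  cut-position-occurs {α} {Δ₁ = Δ₁} {Γ₂} {Δ₂} (inj₂ i) _ h₂ =
    Sum.map₂ (AnyP.++⁺ʳ Δ₁) (defined-or-vacuous α Γ₂ Δ₂ i h₂)

  Successor : Pos → Node → Set
  Successor γ s = ∃[ t ] (ρ γ ≡ just t × Acc M s t)

  ρ-path : Transitive (Acc M) → ∀ α y β {s t} → ρ α ≡ just s → ρ (α ++ y ∷ β) ≡ just t → Acc M s t
  ρ-path _  α y []      e e′ = ρ-mono α y _ _ e e′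
  ρ-path tr α y (z ∷ β) {s} {t} e e′ =
    let u , eu = ρ-prefix (α ++ y ∷ z ∷ β) (α ++ [ y ]) t (z ∷ β , ++-assoc α [ y ] (z ∷ β)) e′
    in tr (ρ-mono α y s u e eu)
          (ρ-path tr (α ++ [ y ]) z β eu (subst (λ γ → ρ γ ≡ just t) (sym (++-assoc α [ y ] (z ∷ β))) e′))

  stay-here : ∀ {α s} → Acc M s s → ρ α ≡ just s → Successor (α ++ []) s
  stay-here {α} {s} s-s e = s , subst (λ γ → ρ γ ≡ just s) (sym (++-identityʳ α)) e , s-s

  one-step : ∀ α y {s} → ρ α ≡ just s → Defined (α ++ [ y ]) → Successor (α ++ [ y ]) s
  one-step α y e (t , e′) = t , e′ , ρ-mono α y _ t e e′

  many-steps : Transitive (Acc M) → ∀ α y β {s} → ρ α ≡ just s → Defined (α ++ y ∷ β) →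
               Successor (α ++ y ∷ β) s
  many-steps tr α y β e (t , e′) = t , e′ , ρ-path tr α y β e e′

open Definedness using (Defined; Successor; stay-here; one-step; many-steps)

successor : ∀ {At} M (S : Structure At M) {α β s} {Γ Δ : List (PFm At)} →
            BoxLCond M α β Γ Δ → Structure.ρ S α ≡ just s → All (Structure.⊨ˡ S) Γ →
            Successor S (α ++ β) s ⊎ Any (Structure.⊨ʳ S) Δ
successor S4 S {β = []}     _ e _ = inj₁ (stay-here S ε e)
successor S4 S {α} {y ∷ β}  _ e _ = inj₁ (many-steps S _◅◅_ α y β e (Structure.ρ-total S _))
successor T  S {β = []}     _ e _ = inj₁ (stay-here S stay e)
successor T  S {α} {y ∷ []} _ e _ = inj₁ (one-step S α y e (Structure.ρ-total S _))
successor T  S {β = _ ∷ _ ∷ _} (s≤s ()) _ _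
successor D  S {α} {y ∷ []} _ e _ = inj₁ (one-step S α y e (Structure.ρ-total S _))
successor D  S {β = []}        () _ _
successor D  S {β = _ ∷ _ ∷ _} () _ _
successor K  S {α} {y ∷ []} {Γ = Γ} {Δ} (_ , wit) e h =
  Sum.map₁ (one-step S α y e) (Definedness.defined-or-vacuous S _ Γ Δ (witness-in-I α _ Γ Δ wit) h)
successor K  S {β = []}        (() , _) _ _
successor K  S {β = _ ∷ _ ∷ _} (() , _) _ _
successor K4 S {β = []} (nonempty , _) _ _ = ⊥-elim (nonempty refl)
successor K4 S {α} {y ∷ β} {Γ = Γ} {Δ} (_ , wit) e h =
  Sum.map₁ (many-steps S (transitive _◁_) α y β e)
       (Definedness.defined-or-vacuous S _ Γ Δ (witness-in-I α _ Γ Δ wit) h)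

cut-position : ∀ {At} M (S : Structure At M) {α} {Γ₁ Δ₁ Γ₂ Δ₂ : List (PFm At)} →
               CutCond M α Γ₁ Δ₁ Γ₂ Δ₂ → All (Structure.⊨ˡ S) Γ₁ → All (Structure.⊨ˡ S) Γ₂ →
               Defined S α ⊎ Any (Structure.⊨ʳ S) (Δ₁ ++ Δ₂)
cut-position K  S c h₁ h₂ = Definedness.cut-position-occurs S c h₁ h₂
cut-position K4 S c h₁ h₂ = Definedness.cut-position-occurs S c h₁ h₂
cut-position D  S _ _  _  = inj₁ (Structure.ρ-total S _)
cut-position T  S _ _  _  = inj₁ (Structure.ρ-total S _)
cut-position S4 S _ _  _  = inj₁ (Structure.ρ-total S _)

classically : ExcludedMiddle 0ℓ → ∀ {A : Set} {P : A → Set} {x xs} →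
              (¬ Any P xs → P x) → Any P (x ∷ xs)
classically em {P = P} {xs = xs} k with em {Any P xs}
... | yes some = there some
... | no none  = here (k none)

on-principal : ∀ {A : Set} {P : A → Set} {x y xs} → (P x → P y) → Any P (x ∷ xs) → Any P (y ∷ xs)
on-principal f (here p)  = here (f p)
on-principal f (there q) = there q

-- The eigen-token rules (⊢□) and (◇⊢) instead use their premise in the
-- grafted structure, hence assume it in every structure.
module Rules (em : ExcludedMiddle 0ℓ) {At M} (S : Structure At M) where
  open Structure S

  axiom-holds : ∀ {φ} → Satisfies [ φ ] [ φ ]
  axiom-holds {A ^ α} ((s , e , a) ∷ []) =
    here λ s′ e′ → subst (_⊩ A) (just-injective (trans (sym e) e′)) a

  cut-holds : ∀ {Γ₁ Γ₂ Δ₁ Δ₂ A α} → CutCond M α Γ₁ Δ₁ Γ₂ Δ₂ →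
              Satisfies Γ₁ ((A ^ α) ∷ Δ₁) → Satisfies ((A ^ α) ∷ Γ₂) Δ₂ →
              Satisfies (Γ₁ ++ Γ₂) (Δ₁ ++ Δ₂)
  cut-holds {Γ₁} {Δ₁ = Δ₁} c left right h with All.++⁻ Γ₁ h
  ... | h₁ , h₂ with left h₁ | cut-position M S c h₁ h₂
  ... | there q | _            = AnyP.++⁺ˡ q
  ... | here _  | inj₂ q       = q
  ... | here a  | inj₁ (s , e) = AnyP.++⁺ʳ Δ₁ (right ((s , e , a s e) ∷ h₂))

  weakL-holds : ∀ {Γ Δ φ} → Satisfies Γ Δ → Satisfies (φ ∷ Γ) Δ
  weakL-holds d (_ ∷ h) = d h

  weakR-holds : ∀ {Γ Δ φ} → Satisfies Γ Δ → Satisfies Γ (φ ∷ Δ)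
  weakR-holds d h = there (d h)

  contrL-holds : ∀ {Γ Δ φ} → Satisfies (φ ∷ φ ∷ Γ) Δ → Satisfies (φ ∷ Γ) Δ
  contrL-holds d (a ∷ h) = d (a ∷ a ∷ h)

  contrR-holds : ∀ {Γ Δ φ} → Satisfies Γ (φ ∷ φ ∷ Δ) → Satisfies Γ (φ ∷ Δ)
  contrR-holds d h with d h
  ... | here a  = here a
  ... | there q = q

  exchL-holds : ∀ {Γ₁ Γ₂ Δ φ ψ} → Satisfies (Γ₁ ++ φ ∷ ψ ∷ Γ₂) Δ → Satisfies (Γ₁ ++ ψ ∷ φ ∷ Γ₂) Δ
  exchL-holds {Γ₁} {φ = φ} {ψ} d h = d (All-resp-↭ (++⁺ˡ Γ₁ (swap ψ φ ↭-refl)) h)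

  exchR-holds : ∀ {Γ Δ₁ Δ₂ φ ψ} → Satisfies Γ (Δ₁ ++ φ ∷ ψ ∷ Δ₂) → Satisfies Γ (Δ₁ ++ ψ ∷ φ ∷ Δ₂)
  exchR-holds {Δ₁ = Δ₁} {φ = φ} {ψ} d h = Any-resp-↭ (++⁺ˡ Δ₁ (swap φ ψ ↭-refl)) (d h)

  negL-holds : ∀ {Γ Δ A α} → Satisfies Γ ((A ^ α) ∷ Δ) → Satisfies (((¬′ A) ^ α) ∷ Γ) Δ
  negL-holds d ((s , e , ¬a) ∷ h) = Any.tail (λ a → ¬a (a s e)) (d h)

  negR-holds : ∀ {Γ Δ A α} → Satisfies ((A ^ α) ∷ Γ) Δ → Satisfies Γ (((¬′ A) ^ α) ∷ Δ)
  negR-holds d h = classically em λ none s e a → none (d ((s , e , a) ∷ h))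

  andL₁-holds : ∀ {Γ Δ A B α} → Satisfies ((A ^ α) ∷ Γ) Δ → Satisfies (((A ∧′ B) ^ α) ∷ Γ) Δ
  andL₁-holds d ((s , e , a , _) ∷ h) = d ((s , e , a) ∷ h)

  andL₂-holds : ∀ {Γ Δ A B α} → Satisfies ((B ^ α) ∷ Γ) Δ → Satisfies (((A ∧′ B) ^ α) ∷ Γ) Δ
  andL₂-holds d ((s , e , _ , b) ∷ h) = d ((s , e , b) ∷ h)

  andR-holds : ∀ {Γ Δ A B α} → Satisfies Γ ((A ^ α) ∷ Δ) → Satisfies Γ ((B ^ α) ∷ Δ) →
               Satisfies Γ (((A ∧′ B) ^ α) ∷ Δ)
  andR-holds d₁ d₂ h with d₁ h | d₂ h
  ... | here a  | here b  = here (λ s e → a s e , b s e)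
  ... | there q | _       = there q
  ... | here _  | there q = there q

  orL-holds : ∀ {Γ Δ A B α} → Satisfies ((A ^ α) ∷ Γ) Δ → Satisfies ((B ^ α) ∷ Γ) Δ →
              Satisfies (((A ∨′ B) ^ α) ∷ Γ) Δ
  orL-holds d₁ d₂ ((s , e , inj₁ a) ∷ h) = d₁ ((s , e , a) ∷ h)
  orL-holds d₁ d₂ ((s , e , inj₂ b) ∷ h) = d₂ ((s , e , b) ∷ h)

  orR₁-holds : ∀ {Γ Δ A B α} → Satisfies Γ ((A ^ α) ∷ Δ) → Satisfies Γ (((A ∨′ B) ^ α) ∷ Δ)
  orR₁-holds d h = on-principal (λ a s e → inj₁ (a s e)) (d h)

  orR₂-holds : ∀ {Γ Δ A B α} → Satisfies Γ ((B ^ α) ∷ Δ) → Satisfies Γ (((A ∨′ B) ^ α) ∷ Δ)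
  orR₂-holds d h = on-principal (λ b s e → inj₂ (b s e)) (d h)

  impL-holds : ∀ {Γ₁ Γ₂ Δ₁ Δ₂ A B α} → Satisfies Γ₁ ((A ^ α) ∷ Δ₁) → Satisfies ((B ^ α) ∷ Γ₂) Δ₂ →
               Satisfies (((A ⇒′ B) ^ α) ∷ (Γ₁ ++ Γ₂)) (Δ₁ ++ Δ₂)
  impL-holds {Γ₁} {Δ₁ = Δ₁} d₁ d₂ ((s , e , a⇒b) ∷ h) with All.++⁻ Γ₁ h
  ... | h₁ , h₂ with d₁ h₁
  ... | there q = AnyP.++⁺ˡ q
  ... | here a  = AnyP.++⁺ʳ Δ₁ (d₂ ((s , e , a⇒b (a s e)) ∷ h₂))

  impR-holds : ∀ {Γ Δ A B α} → Satisfies ((A ^ α) ∷ Γ) ((B ^ α) ∷ Δ) →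
               Satisfies Γ (((A ⇒′ B) ^ α) ∷ Δ)
  impR-holds d h = classically em λ none s e a → Any.head none (d ((s , e , a) ∷ h)) s e

  boxL-holds : ∀ {Γ Δ A α β} → BoxLCond M α β Γ Δ → Satisfies ((A ^ (α ++ β)) ∷ Γ) Δ →
               Satisfies (((□ A) ^ α) ∷ Γ) Δ
  boxL-holds c d ((s , e , □a) ∷ h) with successor M S c e h
  ... | inj₁ (t , e′ , s-t) = d ((t , e′ , □a t (ρ-into _ t e′) s-t) ∷ h)
  ... | inj₂ q              = q

  diaR-holds : ∀ {Γ Δ A α β} → BoxLCond M α β Γ Δ → Satisfies Γ ((A ^ (α ++ β)) ∷ Δ) →
               Satisfies Γ (((◇ A) ^ α) ∷ Δ)
  diaR-holds {Δ = Δ} {A} {α} c d h = classically em witness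
    where
    witness : ¬ Any ⊨ʳ Δ → ⊨ʳ ((◇ A) ^ α)
    witness none s e with successor M S c e h
    ... | inj₁ (t , e′ , s-t) = t , ρ-into _ t e′ , s-t , Any.head none (d h) t e′
    ... | inj₂ q              = ⊥-elim (none q)

  boxR-holds : ∀ {Γ Δ A α} x → ¬ InI (α ++ [ x ]) (Γ ++ Δ) →
               Γ ⊨[ M ] ((A ^ (α ++ [ x ])) ∷ Δ) → Satisfies Γ (((□ A) ^ α) ∷ Δ)
  boxR-holds {Γ} {Δ} {α = α} x fresh premise h = classically em λ none s e t θ s-t →
    let open Graft S α x e θ s-t
    in Any.head (none ∘ agreeʳ Δ (fresh ∘ AnyP.++⁺ʳ Γ))
                (premise grafted (agreeˡ Γ (fresh ∘ AnyP.++⁺ˡ) h)) t graft-root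

  diaL-holds : ∀ {Γ Δ A α} x → ¬ InI (α ++ [ x ]) (Γ ++ Δ) →
               ((A ^ (α ++ [ x ])) ∷ Γ) ⊨[ M ] Δ → Satisfies (((◇ A) ^ α) ∷ Γ) Δ
  diaL-holds {Γ} {Δ} {α = α} x fresh premise ((s , e , t , θ , s-t , a) ∷ h) =
    let open Graft S α x e θ s-t
    in agreeʳ Δ (fresh ∘ AnyP.++⁺ʳ Γ)
              (premise grafted ((t , graft-root , a) ∷ agreeˡ Γ (fresh ∘ AnyP.++⁺ˡ) h))

soundness : ExcludedMiddle 0ℓ → ∀ {At M} {Γ Δ : List (PFm At)} → Deriv M Γ Δ → Γ ⊨[ M ] Δ
soundness em {M = M} d S = holds d
  where
  open Structure S using (Satisfies)
  open Rules em S
  holds : ∀ {Γ Δ} → Deriv M Γ Δ → Satisfies Γ Δ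
  holds ax                  = axiom-holds
  holds (cut c d₁ d₂)       = cut-holds c (holds d₁) (holds d₂)
  holds (weakL d)           = weakL-holds (holds d)
  holds (weakR d)           = weakR-holds (holds d)
  holds (contrL d)          = contrL-holds (holds d)
  holds (contrR d)          = contrR-holds (holds d)
  holds (exchL d)           = exchL-holds (holds d)
  holds (exchR d)           = exchR-holds (holds d)
  holds (negL d)            = negL-holds (holds d)
  holds (negR d)            = negR-holds (holds d)
  holds (andL₁ d)           = andL₁-holds (holds d)
  holds (andL₂ d)           = andL₂-holds (holds d)
  holds (andR d₁ d₂)        = andR-holds (holds d₁) (holds d₂)
  holds (orL d₁ d₂)         = orL-holds (holds d₁) (holds d₂)
  holds (orR₁ d)            = orR₁-holds (holds d)
  holds (orR₂ d)            = orR₂-holds (holds d)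
  holds (impL d₁ d₂)        = impL-holds (holds d₁) (holds d₂)
  holds (impR d)            = impR-holds (holds d)
  holds (boxL c d)          = boxL-holds c (holds d)
  holds (diaR c d)          = diaR-holds c (holds d)
  holds (boxR x fresh d)    = boxR-holds x fresh (soundness em d)
  holds (diaL x fresh d)    = diaL-holds x fresh (soundness em d)

mainTheorem5 : ExcludedMiddle 0ℓ →
    {At : Set} (M : Logic) (Γ Δ : List (PFm At)) →
    Deriv M Γ Δ → Γ ⊨[ M ] Δ
mainTheorem5 em M Γ Δ d = soundness em d
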